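{- For any degree sequence $d=(d_1,\dots,d_n)$, both the intersection envelope graph $I(d)$ and the union envelope graph $U(d)$ are threshold graphs.
   Context: All graphs are finite and simple. Realizations of $d$ are labeled graphs on vertex set $[n]$ in which vertex $\ell$ has degree $d_\ell$. $I(d)$ is the graph on $[n]$ whose edge set is the intersection of the edge sets of all realizations of $d$; $U(d)$ is the graph on $[n]$ whose edge set is the union of the edge sets of all realizations of $d$. A threshold graph is a graph that is the unique (labeled) realization of its degree sequence; equivalently, a graph with no alternating 4-cycle, i.e. no four vertices $a,b,c,e$ with $ab, ce$ edges and $ae, bc$ non-edges. -}

module Defs where

open import Data.Nat using (ℕ)
open import Data.Bool using (Bool; true; false; if_then_else_)
open import Data.Fin using (Fin)
open import Data.List using (List; map)
open import Data.Nat.ListAction using (sum)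
open import Data.List using () renaming (allFin to allFinL)
open import Data.Product using (Σ; _×_; ∃)
open import Function.Bundles using (_⇔_)
open import Relation.Binary.PropositionalEquality using (_≡_)

record Graph (n : ℕ) : Set where
  field
    adj    : Fin n → Fin n → Bool
    sym    : ∀ i j → adj i j ≡ adj j i
    irrefl : ∀ i → adj i i ≡ false
open Graph public

Edge : ∀ {n} → Graph n → Fin n → Fin n → Set
Edge G i j = adj G i j ≡ true

degree : ∀ {n} → Graph n → Fin n → ℕ
degree {n} G i = sum (map (λ j → if adj G i j then 1 else 0) (allFinL n))

Realizes : ∀ {n} → Graph n → (Fin n → ℕ) → Set
Realizes G d = ∀ ℓ → degree G ℓ ≡ d ℓ

IsDegreeSequence : ∀ {n} → (Fin n → ℕ) → Set
IsDegreeSequence {n} d = Σ (Graph n) λ G → Realizes G d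

IsIntersectionEnvelope : ∀ {n} → (Fin n → ℕ) → Graph n → Set
IsIntersectionEnvelope {n} d H =
  ∀ i j → Edge H i j ⇔ (∀ (G : Graph n) → Realizes G d → Edge G i j)

IsUnionEnvelope : ∀ {n} → (Fin n → ℕ) → Graph n → Set
IsUnionEnvelope {n} d H =
  ∀ i j → Edge H i j ⇔ (Σ (Graph n) λ G → Realizes G d × Edge G i j)

-- Threshold graph: the unique labeled realization of its own degree sequence.
IsThreshold : ∀ {n} → Graph n → Set
IsThreshold {n} H =
  ∀ (G : Graph n) → Realizes G (degree H) → ∀ i j → adj G i j ≡ adj H i j

module Submission where

-- The argument has three ingredients.
--  * Counting: degrees are counts of true entries of Boolean rows; we prove the
--    bookkeeping facts about such counts (changing one entry, exchanging two
--    entries, and the "surplus" principle: if count f ≤ count g then every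
--    entry in f but not in g is matched by an entry in g but not in f).
--  * Two-switches (the paper's key lemma): if uv is an edge, u'v is not, u' ≠ v
--    and deg u ≤ deg u', then some w makes u v u' w an alternating 4-cycle;
--    toggling its four pairs gives a realization of the same degree sequence in
--    which v has moved from the neighbourhood of u to that of u'.
--  * A graph whose neighbourhoods are nested along some vertex ranking (a
--    neighbour v of u is also a neighbour of every u' ≠ v ranked at least as
--    high) is threshold: a different realization would yield an infinite
--    strictly descending sequence of ranks.
-- By the key lemma both envelopes are nested along d itself. Finally, the
-- envelopes exist as Boolean graphs because membership of a pair is decidable:
-- graphs on [n] can be searched exhaustively through their codes in Subset (n * n).

open import Defs hiding (sym)
open import Data.Nat using (ℕ; zero; suc; _+_; _≤_; _<_; z≤n; s≤s; _*_)
open import Data.Nat.Properties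
  using (+-assoc; +-comm; +-identityʳ; +-cancelʳ-≡; +-cancelʳ-≤; +-mono-≤; +-mono-≤-<;
         ≤-reflexive; ≤-refl; <⇒≱; ≰⇒>; <-≤-trans; _≤?_)
import Data.Nat.Properties as ℕ
open import Data.Nat.ListAction using (sum)
open import Data.Bool using (Bool; true; false; not; _∧_; _∨_; _xor_; if_then_else_)
open import Data.Bool.Properties
  using (xor-comm; xor-assoc; xor-identityʳ; xor-same; true-xor; not-involutive;
         ∧-comm; ∧-identityʳ; ∧-zeroʳ; ∨-comm; ∨-idem)
import Data.Bool.Properties as 𝔹
open import Data.Fin using (Fin; zero; suc; _≟_; combine; remQuot)
open import Data.Fin.Properties using (suc-injective; any?; all?; remQuot-combine)
open import Data.Fin.Subset using (Subset)
open import Data.Fin.Subset.Properties using (anySubset?)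
open import Data.List using (tabulate)
open import Data.List.Properties using (map-tabulate)
open import Data.Vec using (lookup) renaming (tabulate to tabulateᵛ)
open import Data.Vec.Properties using (lookup∘tabulate)
open import Data.Product using (Σ; _×_; _,_; proj₁; proj₂; uncurry)
open import Data.Empty using (⊥; ⊥-elim)
open import Function using (_∘_)
open import Function.Bundles using (_⇔_; mk⇔; Equivalence)
open import Relation.Nullary using (¬_; Dec; yes; no; does; _×-dec_)
open import Relation.Nullary.Decidable using (dec-true; dec-false; does-⇔; map′)
open import Relation.Binary.PropositionalEquality
  using (_≡_; _≢_; refl; sym; trans; cong; cong₂; subst₂; ≢-sym; module ≡-Reasoning)

private
  variable
    n : ℕ

-- ind b is 1 or 0; count h is the number of true entries of the row h, in the
-- same shape as the definition of degree.
ind : Bool → ℕ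
ind b = if b then 1 else 0

count : (Fin n → Bool) → ℕ
count h = sum (tabulate (λ j → ind (h j)))

degree-count : (G : Graph n) (x : Fin n) → degree G x ≡ count (adj G x)
degree-count G x = cong sum (map-tabulate (λ j → j) (λ j → ind (adj G x j)))

count-cong : {f g : Fin n → Bool} → (∀ j → f j ≡ g j) → count f ≡ count g
count-cong {zero}  f≗g = refl
count-cong {suc n} f≗g = cong₂ _+_ (cong ind (f≗g zero)) (count-cong (f≗g ∘ suc))

_⊆_ : (f g : Fin n → Bool) → Set
f ⊆ g = ∀ j → f j ≡ true → g j ≡ true

ind-mono : {a b : Bool} → (a ≡ true → b ≡ true) → ind a ≤ ind b
ind-mono {false} a⇒b = z≤n
ind-mono {true}  a⇒b with refl ← a⇒b refl = ≤-refl

count-mono : {f g : Fin n → Bool} → f ⊆ g → count f ≤ count g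
count-mono {zero}  f⊆g = z≤n
count-mono {suc n} f⊆g = +-mono-≤ (ind-mono (f⊆g zero)) (count-mono (f⊆g ∘ suc))

count-strict : {f g : Fin n → Bool} → f ⊆ g →
  (j : Fin n) → f j ≡ false → g j ≡ true → count f < count g
count-strict {suc n} {f} {g} f⊆g zero fj gj rewrite fj | gj =
  s≤s (count-mono (f⊆g ∘ suc))
count-strict {suc n} f⊆g (suc j) fj gj =
  +-mono-≤-< (ind-mono (f⊆g zero)) (count-strict (f⊆g ∘ suc) j fj gj)

surplus : (f g : Fin n → Bool) → count f ≤ count g →
  (j : Fin n) → f j ≡ true → g j ≡ false → Σ (Fin n) λ k → g k ≡ true × f k ≡ false
surplus f g f≤g j fj gj with any? (λ k → (g k 𝔹.≟ true) ×-dec (f k 𝔹.≟ false))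
... | yes found = found
... | no none   = ⊥-elim (<⇒≱ (count-strict g⊆f j gj fj) f≤g)
  where
  g⊆f : g ⊆ f
  g⊆f k gk with f k in fk
  ... | true  = refl
  ... | false = ⊥-elim (none (k , gk , fk))

_≡ᵇ_ : Fin n → Fin n → Bool
i ≡ᵇ j = does (i ≟ j)

≡ᵇ-refl : (i : Fin n) → (i ≡ᵇ i) ≡ true
≡ᵇ-refl i = dec-true (i ≟ i) refl

≡ᵇ-false : {i j : Fin n} → i ≢ j → (i ≡ᵇ j) ≡ false
≡ᵇ-false {i = i} {j} = dec-false (i ≟ j)

count-update : (k : Fin n) (f g : Fin n → Bool) → (∀ j → j ≢ k → f j ≡ g j) →
  count f + ind (g k) ≡ count g + ind (f k)
count-update {suc n} zero f g agree = begin
  (ind (f zero) + count (f ∘ suc)) + ind (g zero)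
    ≡⟨ cong (λ c → (ind (f zero) + c) + ind (g zero)) tails ⟩
  (ind (f zero) + count (g ∘ suc)) + ind (g zero)
    ≡⟨ +-comm (ind (f zero) + count (g ∘ suc)) (ind (g zero)) ⟩
  ind (g zero) + (ind (f zero) + count (g ∘ suc))
    ≡⟨ cong (ind (g zero) +_) (+-comm (ind (f zero)) (count (g ∘ suc))) ⟩
  ind (g zero) + (count (g ∘ suc) + ind (f zero))
    ≡⟨ sym (+-assoc (ind (g zero)) (count (g ∘ suc)) (ind (f zero))) ⟩
  (ind (g zero) + count (g ∘ suc)) + ind (f zero) ∎
  where
  open ≡-Reasoning
  tails : count (f ∘ suc) ≡ count (g ∘ suc)
  tails = count-cong (λ j → agree (suc j) (λ ()))
count-update {suc n} (suc k) f g agree = begin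
  (ind (f zero) + count (f ∘ suc)) + ind (g (suc k))
    ≡⟨ +-assoc (ind (f zero)) (count (f ∘ suc)) (ind (g (suc k))) ⟩
  ind (f zero) + (count (f ∘ suc) + ind (g (suc k)))
    ≡⟨ cong₂ _+_ (cong ind (agree zero (λ ()))) tails ⟩
  ind (g zero) + (count (g ∘ suc) + ind (f (suc k)))
    ≡⟨ sym (+-assoc (ind (g zero)) (count (g ∘ suc)) (ind (f (suc k)))) ⟩
  (ind (g zero) + count (g ∘ suc)) + ind (f (suc k)) ∎
  where
  open ≡-Reasoning
  tails : count (f ∘ suc) + ind (g (suc k)) ≡ count (g ∘ suc) + ind (f (suc k))
  tails = count-update k (f ∘ suc) (g ∘ suc) (λ j j≢k → agree (suc j) (j≢k ∘ suc-injective))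

-- Exchanging the entries at two positions a, b does not change the count.
-- (Pass through the row that already carries g's value at a.)
count-swap : (a b : Fin n) (f g : Fin n → Bool) →
  (∀ j → j ≢ a → j ≢ b → f j ≡ g j) → g a ≡ f b → g b ≡ f a → count f ≡ count g
count-swap a b f g agree ga gb = +-cancelʳ-≡ (ind (f b)) (count f) (count g) (begin
  count f + ind (f b)   ≡⟨ cong (λ x → count f + ind x) (sym ha) ⟩
  count f + ind (h a)   ≡⟨ count-update a f h f≗h ⟩
  count h + ind (f a)   ≡⟨ cong (λ x → count h + ind x) (sym gb) ⟩
  count h + ind (g b)   ≡⟨ count-update b h g h≗g ⟩
  count g + ind (h b)   ≡⟨ cong (λ x → count g + ind x) hb ⟩
  count g + ind (f b)   ∎)
  where
  open ≡-Reasoning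
  h : Fin _ → Bool
  h j = if j ≡ᵇ a then f b else f j
  ha : h a ≡ f b
  ha rewrite ≡ᵇ-refl a = refl
  hb : h b ≡ f b
  hb with b ≡ᵇ a
  ... | true  = refl
  ... | false = refl
  f≗h : ∀ j → j ≢ a → f j ≡ h j
  f≗h j j≢a rewrite ≡ᵇ-false j≢a = refl
  h≗g : ∀ j → j ≢ b → h j ≡ g j
  h≗g j j≢b with j ≟ a
  ... | yes refl = sym ga
  ... | no j≢a   = agree j j≢a j≢b

count-toggle₂ : (f : Fin n → Bool) (a b : Fin n) → f a ≡ not (f b) →
  count f ≡ count (λ j → f j xor ((j ≡ᵇ a) xor (j ≡ᵇ b)))
count-toggle₂ f a b fa≡¬fb = count-swap a b f _ off at-a at-b
  where
  a≢b : a ≢ b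
  a≢b refl = 𝔹.not-¬ refl fa≡¬fb
  off : ∀ j → j ≢ a → j ≢ b → f j ≡ f j xor ((j ≡ᵇ a) xor (j ≡ᵇ b))
  off j j≢a j≢b rewrite ≡ᵇ-false j≢a | ≡ᵇ-false j≢b = sym (xor-identityʳ (f j))
  flip : ∀ x → x xor true ≡ not x
  flip x = trans (xor-comm x true) (true-xor x)
  at-a : f a xor ((a ≡ᵇ a) xor (a ≡ᵇ b)) ≡ f b
  at-a rewrite ≡ᵇ-refl a | ≡ᵇ-false a≢b | fa≡¬fb =
    trans (flip (not (f b))) (not-involutive (f b))
  at-b : f b xor ((b ≡ᵇ a) xor (b ≡ᵇ b)) ≡ f a
  at-b rewrite ≡ᵇ-false (≢-sym a≢b) | ≡ᵇ-refl b = trans (flip (f b)) (sym fa≡¬fb)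

without : Fin n → (Fin n → Bool) → Fin n → Bool
without k h j = h j ∧ not (j ≡ᵇ k)

count-without : (k : Fin n) (h : Fin n → Bool) → count h ≡ count (without k h) + ind (h k)
count-without k h = begin
  count h                            ≡⟨ sym (+-identityʳ (count h)) ⟩
  count h + ind false                ≡⟨ cong (λ b → count h + ind b) (sym deleted) ⟩
  count h + ind (without k h k)      ≡⟨ count-update k h (without k h) kept ⟩
  count (without k h) + ind (h k)    ∎
  where
  open ≡-Reasoning
  deleted : without k h k ≡ false
  deleted rewrite ≡ᵇ-refl k = ∧-zeroʳ (h k)
  kept : ∀ j → j ≢ k → h j ≡ without k h j
  kept j j≢k rewrite ≡ᵇ-false j≢k = sym (∧-identityʳ (h j))

without-true : (k : Fin n) (h : Fin n → Bool) (j : Fin n) →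
  without k h j ≡ true → h j ≡ true × j ≢ k
without-true k h j kept with h j | j ≟ k
... | true  | no j≢k = refl , j≢k
without-true k h j () | true  | yes _
without-true k h j () | false | _

without-false : (k : Fin n) (h : Fin n → Bool) {j : Fin n} → j ≢ k →
  without k h j ≡ false → h j ≡ false
without-false k h {j} j≢k dropped rewrite ≡ᵇ-false j≢k = trans (sym (∧-identityʳ (h j))) dropped

clash : {b : Bool} → b ≡ true → b ≡ false → ⊥
clash refl ()

edge-distinct : (G : Graph n) {x y : Fin n} → Edge G x y → x ≢ y
edge-distinct G {x} xy refl = clash xy (irrefl G x)

_⊕_ : Graph n → Graph n → Graph n
G ⊕ S = record
  { adj    = λ x y → adj G x y xor adj S x y
  ; sym    = λ x y → cong₂ _xor_ (Graph.sym G x y) (Graph.sym S x y)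
  ; irrefl = λ x → cong₂ _xor_ (irrefl G x) (irrefl S x)
  }

⊕-degree-cong : (G S S′ : Graph n) (x : Fin n) → (∀ j → adj S x j ≡ adj S′ x j) →
  degree (G ⊕ S) x ≡ degree (G ⊕ S′) x
⊕-degree-cong G S S′ x same = begin
  degree (G ⊕ S) x     ≡⟨ degree-count (G ⊕ S) x ⟩
  count (adj (G ⊕ S) x)  ≡⟨ count-cong (λ j → cong (adj G x j xor_) (same j)) ⟩
  count (adj (G ⊕ S′) x) ≡⟨ sym (degree-count (G ⊕ S′) x) ⟩
  degree (G ⊕ S′) x    ∎
  where open ≡-Reasoning

-- For a ≠ b, link a b x y is true exactly when (x, y) is (a, b) or (b, a).
link : (a b x y : Fin n) → Bool
link a b x y = ((x ≡ᵇ a) ∧ (y ≡ᵇ b)) xor ((x ≡ᵇ b) ∧ (y ≡ᵇ a))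

link-sym : (a b x y : Fin n) → link a b x y ≡ link a b y x
link-sym a b x y = trans (xor-comm ((x ≡ᵇ a) ∧ (y ≡ᵇ b)) ((x ≡ᵇ b) ∧ (y ≡ᵇ a)))
  (cong₂ _xor_ (∧-comm (x ≡ᵇ b) (y ≡ᵇ a)) (∧-comm (x ≡ᵇ a) (y ≡ᵇ b)))

link-diag : (a b x : Fin n) → link a b x x ≡ false
link-diag a b x = trans (cong (((x ≡ᵇ a) ∧ (x ≡ᵇ b)) xor_) (∧-comm (x ≡ᵇ b) (x ≡ᵇ a)))
  (xor-same ((x ≡ᵇ a) ∧ (x ≡ᵇ b)))

link-from : {a b : Fin n} → a ≢ b → (y : Fin n) → link a b a y ≡ (y ≡ᵇ b)
link-from {a = a} a≢b y rewrite ≡ᵇ-refl a | ≡ᵇ-false a≢b = xor-identityʳ (y ≡ᵇ _)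

link-to : {a b : Fin n} → b ≢ a → (y : Fin n) → link a b b y ≡ (y ≡ᵇ a)
link-to {b = b} b≢a y rewrite ≡ᵇ-false b≢a | ≡ᵇ-refl b = refl

link-away : {a b x : Fin n} → x ≢ a → x ≢ b → (y : Fin n) → link a b x y ≡ false
link-away x≢a x≢b y rewrite ≡ᵇ-false x≢a | ≡ᵇ-false x≢b = refl

-- The 4-cycle x₀x₁x₂x₃ as a graph (pairs combined with xor, so that the
-- graph axioms hold without any distinctness assumption).
square : (x₀ x₁ x₂ x₃ : Fin n) → Graph n
square x₀ x₁ x₂ x₃ = record
  { adj    = λ x y → link x₀ x₁ x y xor (link x₁ x₂ x y xor (link x₂ x₃ x y xor link x₃ x₀ x y))
  ; sym    = λ x y → cong₂ _xor_ (link-sym x₀ x₁ x y) (cong₂ _xor_ (link-sym x₁ x₂ x y)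
                       (cong₂ _xor_ (link-sym x₂ x₃ x y) (link-sym x₃ x₀ x y)))
  ; irrefl = λ x → cong₂ _xor_ (link-diag x₀ x₁ x) (cong₂ _xor_ (link-diag x₁ x₂ x)
                       (cong₂ _xor_ (link-diag x₂ x₃ x) (link-diag x₃ x₀ x)))
  }

square-rotate : (x₀ x₁ x₂ x₃ x y : Fin n) →
  adj (square x₀ x₁ x₂ x₃) x y ≡ adj (square x₁ x₂ x₃ x₀) x y
square-rotate x₀ x₁ x₂ x₃ x y = rotate (link x₀ x₁ x y) (link x₁ x₂ x y) (link x₂ x₃ x y) (link x₃ x₀ x y)
  where
  rotate : ∀ p q r s → p xor (q xor (r xor s)) ≡ q xor (r xor (s xor p))
  rotate p q r s = trans (xor-comm p _) (trans (xor-assoc q (r xor s) p) (cong (q xor_) (xor-assoc r s p)))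

square-corner : {x₀ x₁ x₂ x₃ : Fin n} → x₀ ≢ x₁ → x₀ ≢ x₂ → x₀ ≢ x₃ →
  (j : Fin n) → adj (square x₀ x₁ x₂ x₃) x₀ j ≡ (j ≡ᵇ x₁) xor (j ≡ᵇ x₃)
square-corner x₀≢x₁ x₀≢x₂ x₀≢x₃ j = cong₂ _xor_ (link-from x₀≢x₁ j)
  (cong₂ _xor_ (link-away x₀≢x₁ x₀≢x₂ j)
    (cong₂ _xor_ (link-away x₀≢x₂ x₀≢x₃ j) (link-to x₀≢x₃ j)))

square-away : {x₀ x₁ x₂ x₃ x : Fin n} → x ≢ x₀ → x ≢ x₁ → x ≢ x₂ → x ≢ x₃ →
  (j : Fin n) → adj (square x₀ x₁ x₂ x₃) x j ≡ false
square-away x≢x₀ x≢x₁ x≢x₂ x≢x₃ j = cong₂ _xor_ (link-away x≢x₀ x≢x₁ j)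
  (cong₂ _xor_ (link-away x≢x₁ x≢x₂ j)
    (cong₂ _xor_ (link-away x≢x₂ x≢x₃ j) (link-away x≢x₃ x≢x₀ j)))

corner-degree : (G : Graph n) {x₀ x₁ x₂ x₃ : Fin n} → x₀ ≢ x₁ → x₀ ≢ x₂ → x₀ ≢ x₃ →
  adj G x₀ x₁ ≡ not (adj G x₀ x₃) → degree (G ⊕ square x₀ x₁ x₂ x₃) x₀ ≡ degree G x₀
corner-degree G {x₀} {x₁} {x₂} {x₃} x₀≢x₁ x₀≢x₂ x₀≢x₃ differ = begin
  degree (G ⊕ square x₀ x₁ x₂ x₃) x₀
    ≡⟨ degree-count (G ⊕ square x₀ x₁ x₂ x₃) x₀ ⟩
  count (adj (G ⊕ square x₀ x₁ x₂ x₃) x₀)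
    ≡⟨ count-cong (λ j → cong (adj G x₀ j xor_) (square-corner x₀≢x₁ x₀≢x₂ x₀≢x₃ j)) ⟩
  count (λ j → adj G x₀ j xor ((j ≡ᵇ x₁) xor (j ≡ᵇ x₃)))
    ≡⟨ sym (count-toggle₂ (adj G x₀) x₁ x₃ differ) ⟩
  count (adj G x₀)
    ≡⟨ sym (degree-count G x₀) ⟩
  degree G x₀ ∎
  where open ≡-Reasoning

differ : {a b : Bool} → a ≡ true → b ≡ false → a ≡ not b
differ refl refl = refl

differ′ : {a b : Bool} → a ≡ false → b ≡ true → a ≡ not b
differ′ refl refl = refl

record AltSquare (G : Graph n) : Set where
  field
    x₀ x₁ x₂ x₃ : Fin n
    x₀x₁  : adj G x₀ x₁ ≡ true
    x₂x₃  : adj G x₂ x₃ ≡ true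
    x₁x₂  : adj G x₁ x₂ ≡ false
    x₃x₀  : adj G x₃ x₀ ≡ false
    x₁≢x₂ : x₁ ≢ x₂
    x₃≢x₀ : x₃ ≢ x₀

module TwoSwitch {G : Graph n} (c : AltSquare G) where
  open AltSquare c

  switched : Graph n
  switched = G ⊕ square x₀ x₁ x₂ x₃

  x₁x₀ : adj G x₁ x₀ ≡ true
  x₁x₀ = trans (Graph.sym G x₁ x₀) x₀x₁
  x₃x₂ : adj G x₃ x₂ ≡ true
  x₃x₂ = trans (Graph.sym G x₃ x₂) x₂x₃
  x₂x₁ : adj G x₂ x₁ ≡ false
  x₂x₁ = trans (Graph.sym G x₂ x₁) x₁x₂
  x₀x₃ : adj G x₀ x₃ ≡ false
  x₀x₃ = trans (Graph.sym G x₀ x₃) x₃x₀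

  x₀≢x₁ : x₀ ≢ x₁
  x₀≢x₁ = edge-distinct G x₀x₁
  x₂≢x₃ : x₂ ≢ x₃
  x₂≢x₃ = edge-distinct G x₂x₃
  x₀≢x₂ : x₀ ≢ x₂
  x₀≢x₂ refl = clash x₁x₀ x₁x₂
  x₁≢x₃ : x₁ ≢ x₃
  x₁≢x₃ refl = clash x₃x₂ x₁x₂

  rotate¹ : ∀ x y → adj (square x₀ x₁ x₂ x₃) x y ≡ adj (square x₁ x₂ x₃ x₀) x y
  rotate¹ x y = square-rotate x₀ x₁ x₂ x₃ x y
  rotate² : ∀ x y → adj (square x₀ x₁ x₂ x₃) x y ≡ adj (square x₂ x₃ x₀ x₁) x y
  rotate² x y = trans (rotate¹ x y) (square-rotate x₁ x₂ x₃ x₀ x y)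
  rotate³ : ∀ x y → adj (square x₀ x₁ x₂ x₃) x y ≡ adj (square x₃ x₀ x₁ x₂) x y
  rotate³ x y = trans (rotate² x y) (square-rotate x₂ x₃ x₀ x₁ x y)

  -- Each corner is the first vertex of a rotation of the square; every other
  -- vertex keeps its row.
  degree-by-position : ∀ x → Dec (x ≡ x₀) → Dec (x ≡ x₁) → Dec (x ≡ x₂) → Dec (x ≡ x₃) →
    degree switched x ≡ degree G x
  degree-by-position _ (yes refl) _ _ _ =
    corner-degree G x₀≢x₁ x₀≢x₂ (≢-sym x₃≢x₀) (differ x₀x₁ x₀x₃)
  degree-by-position _ (no _) (yes refl) _ _ = trans (⊕-degree-cong G (square x₀ x₁ x₂ x₃) (square x₁ x₂ x₃ x₀) x₁ (rotate¹ x₁))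
    (corner-degree G x₁≢x₂ x₁≢x₃ (≢-sym x₀≢x₁) (differ′ x₁x₂ x₁x₀))
  degree-by-position _ (no _) (no _) (yes refl) _ = trans (⊕-degree-cong G (square x₀ x₁ x₂ x₃) (square x₂ x₃ x₀ x₁) x₂ (rotate² x₂))
    (corner-degree G x₂≢x₃ (≢-sym x₀≢x₂) (≢-sym x₁≢x₂) (differ x₂x₃ x₂x₁))
  degree-by-position _ (no _) (no _) (no _) (yes refl) = trans (⊕-degree-cong G (square x₀ x₁ x₂ x₃) (square x₃ x₀ x₁ x₂) x₃ (rotate³ x₃))
    (corner-degree G x₃≢x₀ (≢-sym x₁≢x₃) (≢-sym x₂≢x₃) (differ′ x₃x₀ x₃x₂))
  degree-by-position x (no x≢x₀) (no x≢x₁) (no x≢x₂) (no x≢x₃) = begin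
    degree switched x       ≡⟨ degree-count switched x ⟩
    count (adj switched x)  ≡⟨ count-cong unchanged ⟩
    count (adj G x)         ≡⟨ sym (degree-count G x) ⟩
    degree G x              ∎
    where
    open ≡-Reasoning
    unchanged : ∀ j → adj switched x j ≡ adj G x j
    unchanged j = trans (cong (adj G x j xor_) (square-away x≢x₀ x≢x₁ x≢x₂ x≢x₃ j))
                        (xor-identityʳ (adj G x j))

  preserves-degree : ∀ x → degree switched x ≡ degree G x
  preserves-degree x = degree-by-position x (x ≟ x₀) (x ≟ x₁) (x ≟ x₂) (x ≟ x₃)

  removes : adj switched x₀ x₁ ≡ false
  removes = cong₂ _xor_ x₀x₁ (trans (square-corner x₀≢x₁ x₀≢x₂ (≢-sym x₃≢x₀) x₁)
                                    (cong₂ _xor_ (≡ᵇ-refl x₁) (≡ᵇ-false x₁≢x₃)))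

  adds : adj switched x₂ x₁ ≡ true
  adds = cong₂ _xor_ x₂x₁ (trans (rotate² x₂ x₁)
    (trans (square-corner x₂≢x₃ (≢-sym x₀≢x₂) (≢-sym x₁≢x₂) x₁)
           (cong₂ _xor_ (≡ᵇ-false x₁≢x₃) (≡ᵇ-refl x₁))))


-- Counting core of the two-switch lemma: if uv is an edge, u′v is not,
-- u′ ≠ v and deg u ≤ deg u′, then u′ has a neighbour w ≠ u not adjacent to u.
-- (Compare the rows of u and u′ with the entries for u′ resp. u removed.)
fresh-neighbour : (G : Graph n) {u u′ v : Fin n} → Edge G u v → adj G u′ v ≡ false →
  u′ ≢ v → degree G u ≤ degree G u′ →
  Σ (Fin n) λ w → Edge G u′ w × adj G w u ≡ false × w ≢ u
fresh-neighbour {n} G {u} {u′} {v} uv u′v u′≢v deg≤ = w , u′w , wu , w≢u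
  where
  f g : Fin n → Bool
  f = without u′ (adj G u)
  g = without u (adj G u′)
  f≤g : count f ≤ count g
  f≤g = +-cancelʳ-≤ (ind (adj G u u′)) (count f) (count g) (begin
    count f + ind (adj G u u′)  ≡⟨ sym (count-without u′ (adj G u)) ⟩
    count (adj G u)             ≡⟨ sym (degree-count G u) ⟩
    degree G u                  ≤⟨ deg≤ ⟩
    degree G u′                 ≡⟨ degree-count G u′ ⟩
    count (adj G u′)            ≡⟨ count-without u (adj G u′) ⟩
    count g + ind (adj G u′ u)  ≡⟨ cong (λ b → count g + ind b) (Graph.sym G u′ u) ⟩
    count g + ind (adj G u u′)  ∎)
    where open ℕ.≤-Reasoning
  fv : f v ≡ true
  fv = cong₂ _∧_ uv (cong not (≡ᵇ-false (≢-sym u′≢v)))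
  gv : g v ≡ false
  gv = cong (_∧ not (v ≡ᵇ u)) u′v
  found : Σ (Fin n) λ k → g k ≡ true × f k ≡ false
  found = surplus f g f≤g v fv gv
  w : Fin n
  w = proj₁ found
  u′w : Edge G u′ w
  u′w = proj₁ (without-true u (adj G u′) w (proj₁ (proj₂ found)))
  w≢u : w ≢ u
  w≢u = proj₂ (without-true u (adj G u′) w (proj₁ (proj₂ found)))
  wu : adj G w u ≡ false
  wu = trans (Graph.sym G w u)
             (without-false u′ (adj G u) (≢-sym (edge-distinct G u′w)) (proj₂ (proj₂ found)))

takeover : {d : Fin n → ℕ} (G : Graph n) → Realizes G d → {u u′ v : Fin n} →
  Edge G u v → adj G u′ v ≡ false → u′ ≢ v → d u ≤ d u′ →
  Σ (Graph n) λ G′ → Realizes G′ d × Edge G′ u′ v × adj G′ u v ≡ false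
takeover G realizes {u} {u′} {v} uv u′v u′≢v du≤du′ =
  switched , (λ x → trans (preserves-degree x) (realizes x)) , adds , removes
  where
  deg≤ : degree G u ≤ degree G u′
  deg≤ = subst₂ _≤_ (sym (realizes u)) (sym (realizes u′)) du≤du′
  fresh : Σ (Fin _) λ w → Edge G u′ w × adj G w u ≡ false × w ≢ u
  fresh = fresh-neighbour G uv u′v u′≢v deg≤
  cycle : AltSquare G
  cycle = record
    { x₀ = u ; x₁ = v ; x₂ = u′ ; x₃ = proj₁ fresh
    ; x₀x₁ = uv ; x₂x₃ = proj₁ (proj₂ fresh)
    ; x₁x₂ = trans (Graph.sym G v u′) u′v ; x₃x₀ = proj₁ (proj₂ (proj₂ fresh))
    ; x₁≢x₂ = ≢-sym u′≢v ; x₃≢x₀ = proj₂ (proj₂ (proj₂ fresh))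
    }
  open TwoSwitch cycle

NestedAlong : Graph n → (Fin n → ℕ) → Set
NestedAlong {n} H r = ∀ (u u′ v : Fin n) → Edge H u v → r u ≤ r u′ → u′ ≢ v → Edge H u′ v

nested⇒threshold : (H : Graph n) (r : Fin n → ℕ) → NestedAlong H r → IsThreshold H
nested⇒threshold {n} H r nested G realizes = agree
  where
  same-count : ∀ x → count (adj G x) ≡ count (adj H x)
  same-count x = trans (sym (degree-count G x)) (trans (realizes x) (degree-count H x))

  Missing : Fin n → Set
  Missing x = Σ (Fin n) λ y → Edge H x y × adj G x y ≡ false

  extra-at : ∀ x y → Edge H x y → adj G x y ≡ false →
    Σ (Fin n) λ z → Edge G x z × adj H x z ≡ false
  extra-at x = surplus (adj H x) (adj G x) (≤-reflexive (sym (same-count x)))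
  missing-at : ∀ x y → Edge G x y → adj H x y ≡ false → Missing x
  missing-at x = surplus (adj G x) (adj H x) (≤-reflexive (same-count x))

  -- A missing edge xy yields an extra edge yz; nestedness forces r z < r x
  -- (otherwise zy ∈ H), and balancing at z yields a missing edge at z.
  descend : ∀ x → Missing x → Σ (Fin n) λ z → r z < r x × Missing z
  descend x (y , xy , xy∉G) = z , rz<rx , missing-at z y zy zy∉H
    where
    extra : Σ (Fin n) λ z → Edge G y z × adj H y z ≡ false
    extra = extra-at y x (trans (Graph.sym H y x) xy) (trans (Graph.sym G y x) xy∉G)
    z : Fin n
    z = proj₁ extra
    zy : Edge G z y
    zy = trans (Graph.sym G z y) (proj₁ (proj₂ extra))
    zy∉H : adj H z y ≡ false
    zy∉H = trans (Graph.sym H z y) (proj₂ (proj₂ extra))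
    rz<rx : r z < r x
    rz<rx with r x ≤? r z
    ... | yes rx≤rz = ⊥-elim (clash (nested x z y xy rx≤rz (edge-distinct G zy)) zy∉H)
    ... | no rx≰rz = ≰⇒> rx≰rz

  no-missing : ∀ k x → r x < k → ¬ Missing x
  no-missing (suc k) x (s≤s rx≤k) m with descend x m
  ... | z , rz<rx , mz = no-missing k z (<-≤-trans rz<rx rx≤k) mz

  agree : ∀ i j → adj G i j ≡ adj H i j
  agree i j with adj H i j in ij∈H | adj G i j in ij∈G
  ... | true  | true  = refl
  ... | false | false = refl
  ... | true  | false = ⊥-elim (no-missing (suc (r i)) i ≤-refl (j , ij∈H , ij∈G))
  ... | false | true  = ⊥-elim (no-missing (suc (r i)) i ≤-refl (missing-at i j ij∈G ij∈H))

-- Graphs on [n] are coded by subsets of Fin (n * n) ≅ Fin n × Fin n.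
code : Graph n → Subset (n * n)
code {n} G = tabulateᵛ (λ k → uncurry (adj G) (remQuot n k))

code-entry : (G : Graph n) (x y : Fin n) → lookup (code G) (combine x y) ≡ adj G x y
code-entry {n} G x y = trans (lookup∘tabulate (λ k → uncurry (adj G) (remQuot n k)) (combine x y))
                             (cong (uncurry (adj G)) (remQuot-combine x y))

decode : Subset (n * n) → Graph n
decode M = record
  { adj    = λ x y → not (x ≡ᵇ y) ∧ (entry x y ∨ entry y x)
  ; sym    = λ x y → cong₂ _∧_ (cong not (does-⇔ (mk⇔ sym sym) (x ≟ y) (y ≟ x)))
                                (∨-comm (entry x y) (entry y x))
  ; irrefl = λ x → cong (λ b → not b ∧ (entry x x ∨ entry x x)) (≡ᵇ-refl x)
  }
  where
  entry : Fin _ → Fin _ → Bool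
  entry x y = lookup M (combine x y)

decode-code : (G : Graph n) (x y : Fin n) → adj (decode (code G)) x y ≡ adj G x y
decode-code G x y with x ≟ y
... | yes refl = sym (irrefl G x)
... | no _     = trans (cong₂ _∨_ (code-entry G x y) (trans (code-entry G y x) (Graph.sym G y x)))
                       (∨-idem (adj G x y))

Extensional : (Graph n → Set) → Set
Extensional {n} P = ∀ (G G′ : Graph n) → (∀ x y → adj G x y ≡ adj G′ x y) → P G → P G′

search : (P : Graph n → Set) → Extensional P → (∀ G → Dec (P G)) → Dec (Σ (Graph n) P)
search P ext P? = map′ (λ (M , p) → decode M , p)
  (λ (G , p) → code G , ext G (decode (code G)) (λ x y → sym (decode-code G x y)) p)
  (anySubset? (P? ∘ decode))

realizes? : (G : Graph n) (d : Fin n → ℕ) → Dec (Realizes G d)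
realizes? G d = all? (λ ℓ → degree G ℓ ℕ.≟ d ℓ)

realizes-ext : (d : Fin n → ℕ) (G G′ : Graph n) → (∀ x y → adj G x y ≡ adj G′ x y) →
  Realizes G d → Realizes G′ d
realizes-ext d G G′ same realizes ℓ = begin
  degree G′ ℓ          ≡⟨ degree-count G′ ℓ ⟩
  count (adj G′ ℓ)     ≡⟨ count-cong (λ j → sym (same ℓ j)) ⟩
  count (adj G ℓ)      ≡⟨ sym (degree-count G ℓ) ⟩
  degree G ℓ           ≡⟨ realizes ℓ ⟩
  d ℓ                  ∎
  where open ≡-Reasoning

InEvery InSome : (Fin n → ℕ) → Fin n → Fin n → Set
InEvery {n} d i j = ∀ (G : Graph n) → Realizes G d → Edge G i j
InSome  {n} d i j = Σ (Graph n) λ G → Realizes G d × Edge G i j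

in-some? : (d : Fin n → ℕ) (i j : Fin n) → Dec (InSome d i j)
in-some? d i j = search (λ G → Realizes G d × Edge G i j)
  (λ G G′ same (realizes , ij) → realizes-ext d G G′ same realizes , trans (sym (same i j)) ij)
  (λ G → realizes? G d ×-dec (adj G i j 𝔹.≟ true))

-- Decided by searching for a realization without the edge ij.
in-every? : (d : Fin n → ℕ) (i j : Fin n) → Dec (InEvery d i j)
in-every? d i j with search (λ G → Realizes G d × adj G i j ≡ false)
  (λ G G′ same (realizes , ij∉G) → realizes-ext d G G′ same realizes , trans (sym (same i j)) ij∉G)
  (λ G → realizes? G d ×-dec (adj G i j 𝔹.≟ false))
... | yes (G , realizes , ij∉G) = no (λ every → clash (every G realizes) ij∉G)
... | no none = yes forced
  where
  forced : InEvery d i j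
  forced G realizes with adj G i j in ij
  ... | true  = refl
  ... | false = ⊥-elim (none (G , realizes , ij))

does≡true⇔ : {P : Set} (p? : Dec P) → (does p? ≡ true) ⇔ P
does≡true⇔ (yes p) = mk⇔ (λ _ → p) (λ _ → refl)
does≡true⇔ (no ¬p) = mk⇔ (λ ()) (λ p → ⊥-elim (¬p p))

relation-graph : (R : Fin n → Fin n → Set) → (∀ i j → Dec (R i j)) →
  (∀ i j → R i j → R j i) → (∀ i → ¬ R i i) → Graph n
relation-graph R R? R-sym R-irrefl = record
  { adj    = λ i j → does (R? i j)
  ; sym    = λ i j → does-⇔ (mk⇔ (R-sym i j) (R-sym j i)) (R? i j) (R? j i)
  ; irrefl = λ i → dec-false (R? i i) (R-irrefl i)
  }

relation-graph-nested : (R : Fin n → Fin n → Set) (R? : ∀ i j → Dec (R i j))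
  (R-sym : ∀ i j → R i j → R j i) (R-irrefl : ∀ i → ¬ R i i) (r : Fin n → ℕ) →
  (∀ u u′ v → R u v → r u ≤ r u′ → u′ ≢ v → R u′ v) →
  NestedAlong (relation-graph R R? R-sym R-irrefl) r
relation-graph-nested R R? _ _ r R-nested u u′ v uv ru≤ru′ u′≢v =
  dec-true (R? u′ v) (R-nested u u′ v (Equivalence.to (does≡true⇔ (R? u v)) uv) ru≤ru′ u′≢v)

in-every-sym : (d : Fin n → ℕ) (i j : Fin n) → InEvery d i j → InEvery d j i
in-every-sym d i j every G realizes = trans (Graph.sym G j i) (every G realizes)

in-some-sym : (d : Fin n → ℕ) (i j : Fin n) → InSome d i j → InSome d j i
in-some-sym d i j (G , realizes , ij) = G , realizes , trans (Graph.sym G j i) ij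

-- Irreflexivity of InEvery needs d to have some realization.
in-every-irrefl : (d : Fin n → ℕ) → IsDegreeSequence d → (i : Fin n) → ¬ InEvery d i i
in-every-irrefl d (G₀ , realizes) i every = clash (every G₀ realizes) (irrefl G₀ i)

in-some-irrefl : (d : Fin n → ℕ) (i : Fin n) → ¬ InSome d i i
in-some-irrefl d i (G , realizes , ii) = clash ii (irrefl G i)

in-every-nested : (d : Fin n → ℕ) (u u′ v : Fin n) →
  InEvery d u v → d u ≤ d u′ → u′ ≢ v → InEvery d u′ v
in-every-nested d u u′ v every du≤du′ u′≢v G realizes with adj G u′ v in u′v
... | true  = refl
... | false with takeover G realizes (every G realizes) u′v u′≢v du≤du′
...   | G′ , realizes′ , _ , uv∉G′ = ⊥-elim (clash (every G′ realizes′) uv∉G′)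

in-some-nested : (d : Fin n → ℕ) (u u′ v : Fin n) →
  InSome d u v → d u ≤ d u′ → u′ ≢ v → InSome d u′ v
in-some-nested d u u′ v (G , realizes , uv) du≤du′ u′≢v with adj G u′ v in u′v
... | true  = G , realizes , u′v
... | false with takeover G realizes uv u′v u′≢v du≤du′
...   | G′ , realizes′ , u′v∈G′ , _ = G′ , realizes′ , u′v∈G′

theorem3p2 : (n : ℕ) (d : Fin n → ℕ) → IsDegreeSequence d →
    (Σ (Graph n) λ H → IsIntersectionEnvelope d H × IsThreshold H)
    × (Σ (Graph n) λ H → IsUnionEnvelope d H × IsThreshold H)
theorem3p2 n d realizable =
    (intersection , (λ i j → does≡true⇔ (in-every? d i j))
                  , nested⇒threshold intersection d
                      (relation-graph-nested (InEvery d) (in-every? d) (in-every-sym d)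
                         (in-every-irrefl d realizable) d (in-every-nested d)))
  , (union , (λ i j → does≡true⇔ (in-some? d i j))
           , nested⇒threshold union d
               (relation-graph-nested (InSome d) (in-some? d) (in-some-sym d)
                  (in-some-irrefl d) d (in-some-nested d)))
  where
  intersection union : Graph n
  intersection = relation-graph (InEvery d) (in-every? d) (in-every-sym d) (in-every-irrefl d realizable)
  union        = relation-graph (InSome d) (in-some? d) (in-some-sym d) (in-some-irrefl d)
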